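{- A permutation $w\in S_n$ is join-irreducible in the middle order $\mathcal{P}_n$ if and only if, in one-line notation, $$w=1\,2\,\cdots\, i\;\, j\;\,(i+1)\,(i+2)\cdots(j-1)\;\,(j+1)\cdots n$$ for some $i\in[0,n-2]$ and $j\in[i+2,n]$.
   Context: For $w\in S_n$, its inversion sequence is $I(w)=(x_1,\ldots,x_n)$ with $x_i=\#\{j<i : w^{ -1}(j)>w^{ -1}(i)\}$. The middle order $\mathcal{P}_n$ is the poset on $S_n$ with $v\le w$ iff $I(v)\le I(w)$ coordinate-wise; it is a finite distributive lattice with minimum the identity permutation, with join and meet given by coordinate-wise max and min of inversion sequences. An element $a$ of a lattice with minimum $\hat 0$ is join-irreducible if $a\neq\hat0$ and $a=b\vee c$ implies $a\in\{b,c\}$. -}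

module Defs where

open import Data.Nat using (ℕ; zero; suc; _+_; _∸_; _≤_; _⊔_; _≤ᵇ_; _≡ᵇ_)
open import Data.Bool using (if_then_else_)
open import Data.Fin using (Fin; toℕ; _<?_)
open import Data.Fin.Permutation using (Permutation′; _⟨$⟩ʳ_; _⟨$⟩ˡ_; _≈_; id)
open import Data.List using (List; length; filter)
open import Data.List using (List)
open import Data.Product using (Σ; _×_; ∃₂)
open import Data.Sum using (_⊎_)
open import Relation.Nullary using (¬_)
open import Relation.Nullary.Decidable using (_×-dec_)
open import Relation.Binary.PropositionalEquality using (_≡_)
import Data.List as L

allFinL : (n : ℕ) → List (Fin n)
allFinL n = L.allFin n

-- Inversion sequence (0-indexed values): for a value i,
--   invSeq w i = #{ j < i : w⁻¹(j) > w⁻¹(i) }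
invSeq : {n : ℕ} → Permutation′ n → Fin n → ℕ
invSeq {n} w i =
  length (filter (λ j → (j <? i) ×-dec ((w ⟨$⟩ˡ i) <? (w ⟨$⟩ˡ j))) (allFinL n))

_≤mid_ : {n : ℕ} → Permutation′ n → Permutation′ n → Set
v ≤mid w = ∀ i → invSeq v i ≤ invSeq w i

-- a = b ∨ c in the middle order (join = coordinatewise max of inversion sequences)
IsJoin : {n : ℕ} → Permutation′ n → Permutation′ n → Permutation′ n → Set
IsJoin a b c = ∀ i → invSeq a i ≡ invSeq b i ⊔ invSeq c i

JoinIrreducible : {n : ℕ} → Permutation′ n → Set
JoinIrreducible {n} a =
  (¬ (a ≈ id)) × (∀ (b c : Permutation′ n) → IsJoin a b c → (a ≈ b) ⊎ (a ≈ c))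

-- The one-line word 1 2 ⋯ i  j  (i+1) (i+2) ⋯ (j-1)  (j+1) ⋯ n,
-- as a function of the 1-indexed position k ↦ letter at position k.
shape : ℕ → ℕ → ℕ → ℕ
shape i j k =
  if k ≤ᵇ i then k
  else if k ≡ᵇ suc i then j
  else if k ≤ᵇ j then k ∸ 1
  else k

-- w has one-line notation shape i j (converting 0-indexed Fin to 1-indexed values)
HasShape : {n : ℕ} → Permutation′ n → ℕ → ℕ → Set
HasShape w i j = ∀ p → suc (toℕ (w ⟨$⟩ʳ p)) ≡ shape i j (suc (toℕ p))

-- The inversion sequence is a bijection from permutations onto the sequences x with x v ≤ v
-- (surjective by inserting the last value, injective by removing it), so it identifies the middle
-- order with the product of the chains [0, v].  In that product the join-irreducibles are the
-- sequences with a single nonzero entry m at some index q, since any x with x q ≠ 0 is the join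
-- of that entry alone and of x with it erased.  Moving the letter j = q + 1 left past the letters
-- i + 1, …, j − 1, where i = q − m, creates exactly m inversions, all involving j, so these
-- sequences belong to the given words.

module Submission where

open import Defs
open import Data.Bool using (Bool; true; false; T; _∧_; if_then_else_)
open import Data.Bool.Properties using (T-∧; T-≡)
open import Data.Fin using (Fin; zero; suc; toℕ; fromℕ; fromℕ<; inject₁; punchIn)
import Data.Fin as Fin
open import Data.Fin.Properties
  using (toℕ<n; toℕ≤pred[n]; toℕ-fromℕ; toℕ-fromℕ<; toℕ-inject₁; toℕ-injective; ¬∀⟶∃¬)
open import Data.Fin.Permutation
  using ( Permutation′; permutation; _⟨$⟩ʳ_; _⟨$⟩ˡ_; _≈_; id; flip; inverseˡ; inverseʳ
        ; remove; insert; punchIn-permute; remove-insert)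
open import Data.List using (length; filter; tabulate)
open import Data.Nat using (ℕ; zero; suc; pred; _+_; _∸_; _⊔_; _≤_; _<_; _<ᵇ_; _≡ᵇ_; z≤n; s≤s; s≤s⁻¹)
open import Data.Nat.Properties
open import Algebra.Properties.CommutativeMonoid.Sum +-0-commutativeMonoid
  using (sum; sum-cong-≗; sum-init-last; sum-permute; sum-replicate-zero)
open import Data.Product using (∃; ∃₂; _×_; _,_; proj₁; proj₂)
open import Data.Sum using (_⊎_; inj₁; inj₂)
import Data.Sum as Sum
open import Function using (_∘_; _⇔_; mk⇔; Equivalence)
import Function
open import Relation.Nullary using (¬_; does; yes; no; contradiction)
open import Relation.Nullary.Decidable using (_×-dec_)
open import Relation.Nullary.Reflects using (Reflects; ofʸ; ofⁿ; fromEquivalence)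
open import Relation.Unary using (Pred; Decidable)
open import Relation.Binary.PropositionalEquality
  using (_≡_; _≢_; ≢-sym; refl; sym; trans; cong; cong₂; subst; _≗_; module ≡-Reasoning)

open ≡-Reasoning

≡ᵇ-reflects-≡ : ∀ m n → Reflects (m ≡ n) (m ≡ᵇ n)
≡ᵇ-reflects-≡ m n = fromEquivalence (≡ᵇ⇒≡ m n) (≡⇒≡ᵇ m n)

¬T⇒≡false : ∀ {b} → ¬ T b → b ≡ false
¬T⇒≡false {false} _  = refl
¬T⇒≡false {true}  ¬t = contradiction _ ¬t

≡ᵇ-refl : ∀ n → (n ≡ᵇ n) ≡ true
≡ᵇ-refl n = Equivalence.to T-≡ (≡⇒≡ᵇ n n refl)

≡ᵇ-false : ∀ {m n} → m ≢ n → (m ≡ᵇ n) ≡ false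
≡ᵇ-false {m} {n} m≢n = ¬T⇒≡false (m≢n ∘ ≡ᵇ⇒≡ m n)

<ᵇ-true : ∀ {m n} → m < n → (m <ᵇ n) ≡ true
<ᵇ-true m<n = Equivalence.to T-≡ (<⇒<ᵇ m<n)

<ᵇ-false : ∀ {m n} → n ≤ m → (m <ᵇ n) ≡ false
<ᵇ-false {m} {n} n≤m = ¬T⇒≡false λ m<ᵇn → <⇒≱ (<ᵇ⇒< m n m<ᵇn) n≤m

-- Counting

indicator : Bool → ℕ
indicator b = if b then 1 else 0

count : ∀ {n} → (Fin n → Bool) → ℕ
count p = sum (indicator ∘ p)

length-filter-tabulate : ∀ {a ℓ} {A : Set a} {P : Pred A ℓ} (P? : Decidable P) {n} (f : Fin n → A) →
                         length (filter P? (tabulate f)) ≡ count (λ j → does (P? (f j)))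
length-filter-tabulate P? {zero}  f = refl
length-filter-tabulate P? {suc n} f with does (P? (f zero))
... | true  = cong suc (length-filter-tabulate P? (f ∘ suc))
... | false = length-filter-tabulate P? (f ∘ suc)

count-cong : ∀ {n} {p q : Fin n → Bool} → p ≗ q → count p ≡ count q
count-cong p≗q = sum-cong-≗ (cong indicator ∘ p≗q)

count-permute : ∀ {n} (p : Fin n → Bool) (π : Permutation′ n) → count (p ∘ (π ⟨$⟩ʳ_)) ≡ count p
count-permute p π = sym (sum-permute (indicator ∘ p) π)

count-init : ∀ {n} (p : Fin (suc n) → Bool) → p (fromℕ n) ≡ false → count p ≡ count (p ∘ inject₁)
count-init p pₙ≡false = begin
  count p                                         ≡⟨ sum-init-last (indicator ∘ p) ⟩
  count (p ∘ inject₁) + indicator (p (fromℕ _))  ≡⟨ cong (λ b → count (p ∘ inject₁) + indicator b) pₙ≡false ⟩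
  count (p ∘ inject₁) + 0                         ≡⟨ +-identityʳ _ ⟩
  count (p ∘ inject₁)                             ∎

count-mono : ∀ {n} {p q : Fin n → Bool} → (∀ j → T (p j) → T (q j)) → count p ≤ count q
count-mono {zero}          _   = z≤n
count-mono {suc n} {p} {q} p⇒q with p zero | q zero | p⇒q zero
... | true  | true  | _ = s≤s (count-mono (p⇒q ∘ suc))
... | true  | false | h = contradiction _ h
... | false | b     | _ = ≤-trans (count-mono (p⇒q ∘ suc)) (m≤n+m _ (indicator b))

count-none : ∀ {n} (p : Fin n → Bool) → (∀ j → ¬ T (p j)) → count p ≡ 0
count-none {n} p none = n≤0⇒n≡0 (≤-trans (count-mono none) (≤-reflexive (sum-replicate-zero n)))

count-<ᵇ-suc : ∀ m a → count {m} (λ k → a <ᵇ suc (toℕ k)) ≡ m ∸ a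
count-<ᵇ-suc zero    zero    = refl
count-<ᵇ-suc zero    (suc a) = refl
count-<ᵇ-suc (suc m) zero    = cong suc (count-<ᵇ-suc m zero)
count-<ᵇ-suc (suc m) (suc a) = count-<ᵇ-suc m a

count-<ᵇ-≤ : ∀ m a → count {m} (λ k → toℕ k <ᵇ a) ≤ a
count-<ᵇ-≤ zero    a       = z≤n
count-<ᵇ-≤ (suc m) zero    = ≤-reflexive (sum-replicate-zero m)
count-<ᵇ-≤ (suc m) (suc a) = s≤s (count-<ᵇ-≤ m a)

data LastView {n : ℕ} : Fin (suc n) → Set where
  last : LastView (fromℕ n)
  init : (k : Fin n) → LastView (inject₁ k)

lastView : ∀ {n} (v : Fin (suc n)) → LastView v
lastView {zero}  zero    = last
lastView {suc n} zero    = init zero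
lastView {suc n} (suc v) with lastView v
... | last   = last
... | init k = init (suc k)

_inverts_at_ : ∀ {n} → (Fin n → ℕ) → Fin n → Fin n → Bool
f inverts j at v = (toℕ j <ᵇ toℕ v) ∧ (f v <ᵇ f j)

inversionsAt : ∀ {n} → (Fin n → ℕ) → Fin n → ℕ
inversionsAt f v = count (λ j → f inverts j at v)

inversionsAt-cong : ∀ {n} (f g : Fin n → ℕ) → (∀ j k → (f j <ᵇ f k) ≡ (g j <ᵇ g k)) →
                    ∀ v → inversionsAt f v ≡ inversionsAt g v
inversionsAt-cong f g same-order v = count-cong λ j → cong ((toℕ j <ᵇ toℕ v) ∧_) (same-order v j)

inversionsAt-cong-≗ : ∀ {n} {f g : Fin n → ℕ} → f ≗ g → ∀ v → inversionsAt f v ≡ inversionsAt g v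
inversionsAt-cong-≗ {f = f} {g} f≗g = inversionsAt-cong f g λ j k → cong₂ _<ᵇ_ (f≗g j) (f≗g k)

inversionsAt-inject₁ : ∀ {n} (f : Fin (suc n) → ℕ) v →
                       inversionsAt f (inject₁ v) ≡ inversionsAt (f ∘ inject₁) v
inversionsAt-inject₁ {n} f v =
  trans (count-init (λ j → f inverts j at inject₁ v) last-false) (count-cong same)
  where
  last-false : f inverts fromℕ n at inject₁ v ≡ false
  last-false rewrite toℕ-fromℕ n | toℕ-inject₁ v | <ᵇ-false (<⇒≤ (toℕ<n v)) = refl
  same : ∀ j → f inverts inject₁ j at inject₁ v ≡ (f ∘ inject₁) inverts j at v
  same j rewrite toℕ-inject₁ j | toℕ-inject₁ v = refl

inversionsAt-last : ∀ {n} (f : Fin (suc n) → ℕ) →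
                    inversionsAt f (fromℕ n) ≡ count {n} (λ j → f (fromℕ n) <ᵇ f (inject₁ j))
inversionsAt-last {n} f =
  trans (count-init (λ j → f inverts j at fromℕ n) last-false) (count-cong earlier)
  where
  last-false : f inverts fromℕ n at fromℕ n ≡ false
  last-false rewrite <ᵇ-false (≤-refl {toℕ (fromℕ n)}) = refl
  earlier : ∀ j → f inverts inject₁ j at fromℕ n ≡ (f (fromℕ n) <ᵇ f (inject₁ j))
  earlier j rewrite toℕ-inject₁ j | toℕ-fromℕ n | <ᵇ-true (toℕ<n j) = refl

inversionsAt-≤ : ∀ {n} (f : Fin n → ℕ) v → inversionsAt f v ≤ toℕ v
inversionsAt-≤ {n} f v =
  ≤-trans (count-mono {p = λ j → f inverts j at v} {q = λ j → toℕ j <ᵇ toℕ v} λ j → proj₁ ∘ Equivalence.to T-∧)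
          (count-<ᵇ-≤ n (toℕ v))

inversionsAt-≡0 : ∀ {n} (f : Fin n → ℕ) v → (∀ j → toℕ j < toℕ v → f j ≤ f v) → inversionsAt f v ≡ 0
inversionsAt-≡0 f v increasing = count-none (λ j → f inverts j at v) λ j inversion →
  let (j<v , fv<fj) = Equivalence.to T-∧ inversion
  in <⇒≱ (<ᵇ⇒< _ _ fv<fj) (increasing j (<ᵇ⇒< _ _ j<v))

-- Inversion sequences of permutations

lehmer : ∀ {n} → Permutation′ n → Fin n → ℕ
lehmer π = inversionsAt (toℕ ∘ (π ⟨$⟩ʳ_))

punchIn-fromℕ : ∀ {n} (k : Fin n) → punchIn (fromℕ n) k ≡ inject₁ k
punchIn-fromℕ zero    = refl
punchIn-fromℕ (suc k) = cong suc (punchIn-fromℕ k)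

punchIn-<ᵇ : ∀ {n} (i : Fin (suc n)) (a b : Fin n) →
             (toℕ (punchIn i a) <ᵇ toℕ (punchIn i b)) ≡ (toℕ a <ᵇ toℕ b)
punchIn-<ᵇ zero    a       b       = refl
punchIn-<ᵇ (suc i) zero    zero    = refl
punchIn-<ᵇ (suc i) zero    (suc b) = refl
punchIn-<ᵇ (suc i) (suc a) zero    = refl
punchIn-<ᵇ (suc i) (suc a) (suc b) = punchIn-<ᵇ i a b

permute-inject₁ : ∀ {n} (π : Permutation′ (suc n)) k →
                  π ⟨$⟩ʳ inject₁ k ≡ punchIn (π ⟨$⟩ʳ fromℕ n) (remove (fromℕ n) π ⟨$⟩ʳ k)
permute-inject₁ {n} π k = trans (cong (π ⟨$⟩ʳ_) (sym (punchIn-fromℕ k))) (punchIn-permute π (fromℕ n) k)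

insert-self : ∀ {n} i j (π : Permutation′ n) → insert i j π ⟨$⟩ʳ i ≡ j
insert-self i j π with i Fin.≟ i
... | yes _   = refl
... | no i≢i = contradiction refl i≢i

lehmer-cong : ∀ {n} {π ρ : Permutation′ n} → π ≈ ρ → ∀ v → lehmer π v ≡ lehmer ρ v
lehmer-cong π≈ρ = inversionsAt-cong-≗ (cong toℕ ∘ π≈ρ)

lehmer-≤ : ∀ {n} (π : Permutation′ n) v → lehmer π v ≤ toℕ v
lehmer-≤ π = inversionsAt-≤ (toℕ ∘ (π ⟨$⟩ʳ_))

lehmer-id : ∀ {n} (v : Fin n) → lehmer id v ≡ 0
lehmer-id v = inversionsAt-≡0 toℕ v λ _ → <⇒≤

lehmer-inject₁ : ∀ {n} (π : Permutation′ (suc n)) k → lehmer π (inject₁ k) ≡ lehmer (remove (fromℕ n) π) k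
lehmer-inject₁ {n} π k =
  trans (inversionsAt-inject₁ (toℕ ∘ (π ⟨$⟩ʳ_)) k)
        (inversionsAt-cong (toℕ ∘ (π ⟨$⟩ʳ_) ∘ inject₁) (toℕ ∘ (remove (fromℕ n) π ⟨$⟩ʳ_)) same-order k)
  where
  same-order : ∀ a b → (toℕ (π ⟨$⟩ʳ inject₁ a) <ᵇ toℕ (π ⟨$⟩ʳ inject₁ b))
                     ≡ (toℕ (remove (fromℕ n) π ⟨$⟩ʳ a) <ᵇ toℕ (remove (fromℕ n) π ⟨$⟩ʳ b))
  same-order a b rewrite permute-inject₁ π a | permute-inject₁ π b =
    punchIn-<ᵇ (π ⟨$⟩ʳ fromℕ n) (remove (fromℕ n) π ⟨$⟩ʳ a) (remove (fromℕ n) π ⟨$⟩ʳ b)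

lehmer-last : ∀ {n} (π : Permutation′ (suc n)) → lehmer π (fromℕ n) ≡ n ∸ toℕ (π ⟨$⟩ʳ fromℕ n)
lehmer-last {n} π = begin
  lehmer π (fromℕ n)                        ≡⟨ inversionsAt-last (toℕ ∘ (π ⟨$⟩ʳ_)) ⟩
  count {n} (λ j → L <ᵇ toℕ (π ⟨$⟩ʳ inject₁ j)) ≡⟨ count-init (λ j → L <ᵇ toℕ (π ⟨$⟩ʳ j)) (<ᵇ-false (≤-refl {L})) ⟨
  count (λ j → L <ᵇ toℕ (π ⟨$⟩ʳ j))         ≡⟨ count-permute (λ j → L <ᵇ toℕ j) π ⟩
  count {suc n} (λ j → L <ᵇ toℕ j)          ≡⟨ count-<ᵇ-suc n L ⟩
  n ∸ L                                     ∎
  where L = toℕ (π ⟨$⟩ʳ fromℕ n)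

≈-from-last-remove : ∀ {n} {π ρ : Permutation′ (suc n)} →
                     π ⟨$⟩ʳ fromℕ n ≡ ρ ⟨$⟩ʳ fromℕ n → remove (fromℕ n) π ≈ remove (fromℕ n) ρ → π ≈ ρ
≈-from-last-remove {π = π} {ρ} same-last same-rest v with lastView v
... | last   = same-last
... | init k = begin
  π ⟨$⟩ʳ inject₁ k                                          ≡⟨ permute-inject₁ π k ⟩
  punchIn (π ⟨$⟩ʳ fromℕ _) (remove (fromℕ _) π ⟨$⟩ʳ k)     ≡⟨ cong₂ punchIn same-last (same-rest k) ⟩
  punchIn (ρ ⟨$⟩ʳ fromℕ _) (remove (fromℕ _) ρ ⟨$⟩ʳ k)     ≡⟨ permute-inject₁ ρ k ⟨
  ρ ⟨$⟩ʳ inject₁ k                                          ∎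

lehmer-injective : ∀ {n} (π ρ : Permutation′ n) → (∀ v → lehmer π v ≡ lehmer ρ v) → π ≈ ρ
lehmer-injective {zero}  π ρ _    ()
lehmer-injective {suc n} π ρ same = ≈-from-last-remove {π = π} {ρ} same-last same-rest
  where
  same-last : π ⟨$⟩ʳ fromℕ n ≡ ρ ⟨$⟩ʳ fromℕ n
  same-last = toℕ-injective (∸-cancelˡ-≡ (toℕ≤pred[n] _) (toℕ≤pred[n] _)
    (trans (sym (lehmer-last π)) (trans (same (fromℕ n)) (lehmer-last ρ))))
  same-rest : remove (fromℕ n) π ≈ remove (fromℕ n) ρ
  same-rest = lehmer-injective (remove (fromℕ n) π) (remove (fromℕ n) ρ) λ k →
    trans (sym (lehmer-inject₁ π k)) (trans (same (inject₁ k)) (lehmer-inject₁ ρ k))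

lehmer-surjective : ∀ {n} (x : Fin n → ℕ) → (∀ v → x v ≤ toℕ v) → ∃ λ π → ∀ v → lehmer π v ≡ x v
lehmer-surjective {zero}  x _  = id , λ ()
lehmer-surjective {suc n} x x≤ = π , lehmer-π
  where
  xₙ≤n : x (fromℕ n) ≤ n
  xₙ≤n = subst (x (fromℕ n) ≤_) (toℕ-fromℕ n) (x≤ (fromℕ n))
  rest : ∃ λ ρ → ∀ k → lehmer ρ k ≡ x (inject₁ k)
  rest = lehmer-surjective (x ∘ inject₁) λ k → subst (x (inject₁ k) ≤_) (toℕ-inject₁ k) (x≤ (inject₁ k))
  ρ : Permutation′ n
  ρ = proj₁ rest
  n∸xₙ<1+n : n ∸ x (fromℕ n) < suc n
  n∸xₙ<1+n = s≤s (m∸n≤m n (x (fromℕ n)))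
  π : Permutation′ (suc n)
  π = insert (fromℕ n) (fromℕ< n∸xₙ<1+n) ρ
  lehmer-π : ∀ v → lehmer π v ≡ x v
  lehmer-π v with lastView v
  ... | last = begin
    lehmer π (fromℕ n)              ≡⟨ lehmer-last π ⟩
    n ∸ toℕ (π ⟨$⟩ʳ fromℕ n)       ≡⟨ cong (λ i → n ∸ toℕ i) (insert-self (fromℕ n) _ ρ) ⟩
    n ∸ toℕ (fromℕ< n∸xₙ<1+n)      ≡⟨ cong (n ∸_) (toℕ-fromℕ< n∸xₙ<1+n) ⟩
    n ∸ (n ∸ x (fromℕ n))           ≡⟨ m∸[m∸n]≡n xₙ≤n ⟩
    x (fromℕ n)                     ∎
  ... | init k = begin
    lehmer π (inject₁ k)               ≡⟨ lehmer-inject₁ π k ⟩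
    lehmer (remove (fromℕ n) π) k      ≡⟨ lehmer-cong {π = remove (fromℕ n) π} {ρ} (remove-insert (fromℕ n) _ ρ) k ⟩
    lehmer ρ k                         ≡⟨ proj₂ rest k ⟩
    x (inject₁ k)                      ∎

invSeq≡lehmer-flip : ∀ {n} (w : Permutation′ n) v → invSeq w v ≡ lehmer (flip w) v
invSeq≡lehmer-flip {n} w v =
  length-filter-tabulate (λ j → (j Fin.<? v) ×-dec ((w ⟨$⟩ˡ v) Fin.<? (w ⟨$⟩ˡ j))) {n} Function.id

flip-cong : ∀ {n} {π ρ : Permutation′ n} → π ≈ ρ → flip π ≈ flip ρ
flip-cong {π = π} {ρ} π≈ρ v = begin
  π ⟨$⟩ˡ v                          ≡⟨ inverseˡ ρ ⟨
  ρ ⟨$⟩ˡ (ρ ⟨$⟩ʳ (π ⟨$⟩ˡ v))        ≡⟨ cong (ρ ⟨$⟩ˡ_) (π≈ρ (π ⟨$⟩ˡ v)) ⟨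
  ρ ⟨$⟩ˡ (π ⟨$⟩ʳ (π ⟨$⟩ˡ v))        ≡⟨ cong (ρ ⟨$⟩ˡ_) (inverseʳ π {v}) ⟩
  ρ ⟨$⟩ˡ v                          ∎

invSeq-cong : ∀ {n} (w w′ : Permutation′ n) → w ≈ w′ → ∀ v → invSeq w v ≡ invSeq w′ v
invSeq-cong w w′ w≈w′ v = begin
  invSeq w v             ≡⟨ invSeq≡lehmer-flip w v ⟩
  lehmer (flip w) v      ≡⟨ lehmer-cong {π = flip w} {flip w′} (flip-cong {π = w} {w′} w≈w′) v ⟩
  lehmer (flip w′) v     ≡⟨ invSeq≡lehmer-flip w′ v ⟨
  invSeq w′ v            ∎

invSeq-injective : ∀ {n} (w w′ : Permutation′ n) → (∀ v → invSeq w v ≡ invSeq w′ v) → w ≈ w′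
invSeq-injective w w′ same = flip-cong {π = flip w} {flip w′} (lehmer-injective (flip w) (flip w′) λ v →
  trans (sym (invSeq≡lehmer-flip w v)) (trans (same v) (invSeq≡lehmer-flip w′ v)))

invSeq-surjective : ∀ {n} (x : Fin n → ℕ) → (∀ v → x v ≤ toℕ v) → ∃ λ w → ∀ v → invSeq w v ≡ x v
invSeq-surjective x x≤ =
  let (π , lehmer-π) = lehmer-surjective x x≤
  in flip π , λ v → trans (invSeq≡lehmer-flip (flip π) v) (lehmer-π v)

invSeq-≤ : ∀ {n} (w : Permutation′ n) v → invSeq w v ≤ toℕ v
invSeq-≤ w v = subst (_≤ toℕ v) (sym (invSeq≡lehmer-flip w v)) (lehmer-≤ (flip w) v)

invSeq-id : ∀ {n} (v : Fin n) → invSeq id v ≡ 0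
invSeq-id v = trans (invSeq≡lehmer-flip id v) (lehmer-id v)

-- Sequences supported at a single index

single : ∀ {n} → ℕ → ℕ → Fin n → ℕ
single q m v = if toℕ v ≡ᵇ q then m else 0

erase : ∀ {n} → ℕ → (Fin n → ℕ) → Fin n → ℕ
erase q x v = if toℕ v ≡ᵇ q then 0 else x v

single-≡ : ∀ {n q m} {v : Fin n} → toℕ v ≡ q → single q m v ≡ m
single-≡ {v = v} refl rewrite ≡ᵇ-refl (toℕ v) = refl

single-≢ : ∀ {n q m} {v : Fin n} → toℕ v ≢ q → single q m v ≡ 0
single-≢ v≢q rewrite ≡ᵇ-false v≢q = refl

single-≤ : ∀ {n q m} → m ≤ q → (v : Fin n) → single q m v ≤ toℕ v
single-≤ {q = q} m≤q v with toℕ v ≡ᵇ q | ≡ᵇ-reflects-≡ (toℕ v) q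
... | true  | ofʸ refl = m≤q
... | false | _         = z≤n

erase-≤ : ∀ {n q} {x : Fin n → ℕ} → (∀ v → x v ≤ toℕ v) → ∀ v → erase q x v ≤ toℕ v
erase-≤ {q = q} x≤ v with toℕ v ≡ᵇ q
... | true  = z≤n
... | false = x≤ v

erase-self : ∀ {n} (x : Fin n → ℕ) Q → erase (toℕ Q) x Q ≡ 0
erase-self x Q rewrite ≡ᵇ-refl (toℕ Q) = refl

≡single⊔erase : ∀ {n} (x : Fin n → ℕ) Q v → x v ≡ single (toℕ Q) (x Q) v ⊔ erase (toℕ Q) x v
≡single⊔erase x Q v with toℕ v ≡ᵇ toℕ Q | ≡ᵇ-reflects-≡ (toℕ v) (toℕ Q)
... | true  | ofʸ v≡Q = trans (cong x (toℕ-injective v≡Q)) (sym (⊔-identityʳ (x Q)))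
... | false | _        = refl

single-joinIrreducible : ∀ {n} {x y z : Fin n → ℕ} {m} (Q : Fin n) →
                         (∀ v → x v ≡ single (toℕ Q) m v) → (∀ v → x v ≡ y v ⊔ z v) →
                         (∀ v → y v ≡ x v) ⊎ (∀ v → z v ≡ x v)
single-joinIrreducible {x = x} {y} {z} Q x-single x≡y⊔z =
  Sum.map (max-at-Q⇒≡ y z x≡y⊔z)
          (λ z-max → max-at-Q⇒≡ z y (λ v → trans (x≡y⊔z v) (⊔-comm (y v) (z v))) (trans (⊔-comm (z Q) (y Q)) z-max))
          (⊔-sel (y Q) (z Q))
  where
  max-at-Q⇒≡ : ∀ y z → (∀ v → x v ≡ y v ⊔ z v) → y Q ⊔ z Q ≡ y Q → ∀ v → y v ≡ x v
  max-at-Q⇒≡ y z x≡y⊔z y-max v with toℕ v ≟ toℕ Q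
  ... | yes v≡Q with refl ← toℕ-injective v≡Q = trans (sym y-max) (sym (x≡y⊔z v))
  ... | no  v≢Q = trans (n≤0⇒n≡0 yᵥ≤0) (sym xᵥ≡0)
    where
    xᵥ≡0 : x v ≡ 0
    xᵥ≡0 = trans (x-single v) (single-≢ v≢Q)
    yᵥ≤0 : y v ≤ 0
    yᵥ≤0 = ≤-trans (m≤m⊔n (y v) (z v)) (≤-reflexive (trans (sym (x≡y⊔z v)) xᵥ≡0))

single⇒joinIrreducible : ∀ {n q m} (w : Permutation′ n) →
                         q < n → 0 < m → (∀ v → invSeq w v ≡ single q m v) → JoinIrreducible w
single⇒joinIrreducible {n} {q} {m} w q<n 0<m w-single = w≉id , irreducible
  where
  Q : Fin n
  Q = fromℕ< q<n
  w-single′ : ∀ v → invSeq w v ≡ single (toℕ Q) m v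
  w-single′ v rewrite toℕ-fromℕ< q<n = w-single v
  w≉id : ¬ w ≈ id
  w≉id w≈id = <⇒≢ 0<m (begin
    0                   ≡⟨ invSeq-id Q ⟨
    invSeq id Q         ≡⟨ invSeq-cong w id w≈id Q ⟨
    invSeq w Q          ≡⟨ w-single′ Q ⟩
    single (toℕ Q) m Q  ≡⟨ single-≡ {v = Q} refl ⟩
    m                   ∎)
  irreducible : ∀ b c → IsJoin w b c → w ≈ b ⊎ w ≈ c
  irreducible b c w≡b⊔c =
    Sum.map (λ b≡w → invSeq-injective w b (sym ∘ b≡w)) (λ c≡w → invSeq-injective w c (sym ∘ c≡w))
            (single-joinIrreducible Q w-single′ w≡b⊔c)

joinIrreducible⇒single : ∀ {n} (w : Permutation′ n) → JoinIrreducible w →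
                         ∃₂ λ q m → 0 < m × m ≤ q × q < n × (∀ v → invSeq w v ≡ single q m v)
joinIrreducible⇒single {n} w (w≉id , irreducible) =
  let (Q , xQ≢0) = ¬∀⟶∃¬ n _ (λ v → x v ≟ 0) λ x≡0 →
                     w≉id (invSeq-injective w id λ v → trans (x≡0 v) (sym (invSeq-id v)))
  in  toℕ Q , x Q , n≢0⇒n>0 xQ≢0 , invSeq-≤ w Q , toℕ<n Q , x-single Q xQ≢0
  where
  x : Fin n → ℕ
  x = invSeq w
  x-single : ∀ Q → x Q ≢ 0 → ∀ v → x v ≡ single (toℕ Q) (x Q) v
  x-single Q xQ≢0
    with b , b-single ← invSeq-surjective (single (toℕ Q) (x Q)) (single-≤ (invSeq-≤ w Q))
       | c , c-erase ← invSeq-surjective (erase (toℕ Q) x) (erase-≤ (invSeq-≤ w))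
    with irreducible b c (λ v → trans (≡single⊔erase x Q v) (sym (cong₂ _⊔_ (b-single v) (c-erase v))))
  ... | inj₁ w≈b = λ v → trans (invSeq-cong w b w≈b v) (b-single v)
  ... | inj₂ w≈c = contradiction (trans (invSeq-cong w c w≈c Q) (trans (c-erase Q) (erase-self x Q))) xQ≢0

-- The words 1 2 ⋯ i j (i+1) ⋯ (j-1) (j+1) ⋯ n

-- shape₀ i q is shape i (suc q) with positions and letters counted from 0; shape⁻¹ i q is its inverse.
shape₀ : ℕ → ℕ → ℕ → ℕ
shape₀ i q p = if p <ᵇ i then p else if p ≡ᵇ i then q else if p <ᵇ suc q then pred p else p

shape⁻¹ : ℕ → ℕ → ℕ → ℕ
shape⁻¹ i q v = if v <ᵇ i then v else if v ≡ᵇ q then i else if v <ᵇ q then suc v else v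

suc-shape₀ : ∀ i q p → suc (shape₀ i q p) ≡ shape i (suc q) (suc p)
suc-shape₀ zero    q zero    = refl
suc-shape₀ (suc i) q zero    = refl
suc-shape₀ i       q (suc p) with suc p <ᵇ i | suc p ≡ᵇ i | p <ᵇ q
... | true  | _     | _     = refl
... | false | true  | _     = refl
... | false | false | true  = refl
... | false | false | false = refl

module _ {i q : ℕ} where

  shape₀-< : ∀ {p} → p < i → shape₀ i q p ≡ p
  shape₀-< p<i rewrite <ᵇ-true p<i = refl

  shape₀-i : shape₀ i q i ≡ q
  shape₀-i rewrite <ᵇ-false (≤-refl {i}) | ≡ᵇ-refl i = refl

  shape₀-mid : ∀ {p} → i ≤ p → p < q → shape₀ i q (suc p) ≡ p
  shape₀-mid i≤p p<q
    rewrite <ᵇ-false (m≤n⇒m≤1+n i≤p) | ≡ᵇ-false (≢-sym (<⇒≢ (s≤s i≤p))) | <ᵇ-true (s≤s p<q) = refl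

  shape₀-> : ∀ {p} → i ≤ q → q < p → shape₀ i q p ≡ p
  shape₀-> i≤q q<p
    rewrite <ᵇ-false (≤-trans i≤q (<⇒≤ q<p)) | ≡ᵇ-false (≢-sym (<⇒≢ (≤-<-trans i≤q q<p))) | <ᵇ-false q<p = refl

  shape⁻¹-< : ∀ {v} → v < i → shape⁻¹ i q v ≡ v
  shape⁻¹-< v<i rewrite <ᵇ-true v<i = refl

  shape⁻¹-q : i ≤ q → shape⁻¹ i q q ≡ i
  shape⁻¹-q i≤q rewrite <ᵇ-false i≤q | ≡ᵇ-refl q = refl

  shape⁻¹-mid : ∀ {v} → i ≤ v → v < q → shape⁻¹ i q v ≡ suc v
  shape⁻¹-mid i≤v v<q rewrite <ᵇ-false i≤v | ≡ᵇ-false (<⇒≢ v<q) | <ᵇ-true v<q = refl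

  shape⁻¹-pred : ∀ {v} → i < v → v ≤ q → shape⁻¹ i q (pred v) ≡ v
  shape⁻¹-pred {suc v} (s≤s i≤v) v<q = shape⁻¹-mid i≤v v<q

  shape⁻¹-> : ∀ {v} → i ≤ q → q < v → shape⁻¹ i q v ≡ v
  shape⁻¹-> i≤q q<v
    rewrite <ᵇ-false (≤-trans i≤q (<⇒≤ q<v)) | ≡ᵇ-false (≢-sym (<⇒≢ q<v)) | <ᵇ-false (<⇒≤ q<v) = refl

  shape⁻¹-shape₀ : i ≤ q → ∀ p → shape⁻¹ i q (shape₀ i q p) ≡ p
  shape⁻¹-shape₀ i≤q p with p <ᵇ i | <ᵇ-reflects-< p i
  ... | true  | ofʸ p<i = shape⁻¹-< p<i
  ... | false | ofⁿ p≮i with p ≡ᵇ i | ≡ᵇ-reflects-≡ p i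
  ...   | true  | ofʸ refl = shape⁻¹-q i≤q
  ...   | false | ofⁿ p≢i with p <ᵇ suc q | <ᵇ-reflects-< p (suc q)
  ...     | true  | ofʸ p<1+q = shape⁻¹-pred (≤∧≢⇒< (≮⇒≥ p≮i) (≢-sym p≢i)) (s≤s⁻¹ p<1+q)
  ...     | false | ofⁿ p≮1+q = shape⁻¹-> i≤q (≮⇒≥ p≮1+q)

  shape₀-shape⁻¹ : i ≤ q → ∀ v → shape₀ i q (shape⁻¹ i q v) ≡ v
  shape₀-shape⁻¹ i≤q v with v <ᵇ i | <ᵇ-reflects-< v i
  ... | true  | ofʸ v<i = shape₀-< v<i
  ... | false | ofⁿ v≮i with v ≡ᵇ q | ≡ᵇ-reflects-≡ v q
  ...   | true  | ofʸ refl = shape₀-i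
  ...   | false | ofⁿ v≢q with v <ᵇ q | <ᵇ-reflects-< v q
  ...     | true  | ofʸ v<q = shape₀-mid (≮⇒≥ v≮i) v<q
  ...     | false | ofⁿ v≮q = shape₀-> i≤q (≤∧≢⇒< (≮⇒≥ v≮q) (≢-sym v≢q))

  shape₀-<n : ∀ {n p} → q < n → p < n → shape₀ i q p < n
  shape₀-<n {n} {p} q<n p<n with p <ᵇ i
  ... | true = p<n
  ... | false with p ≡ᵇ i
  ...   | true = q<n
  ...   | false with p <ᵇ suc q
  ...     | true  = ≤-<-trans pred[n]≤n p<n
  ...     | false = p<n

  shape⁻¹-<n : ∀ {n v} → i ≤ q → q < n → v < n → shape⁻¹ i q v < n
  shape⁻¹-<n {n} {v} i≤q q<n v<n with v <ᵇ i
  ... | true = v<n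
  ... | false with v ≡ᵇ q
  ...   | true = ≤-<-trans i≤q q<n
  ...   | false with v <ᵇ q | <ᵇ-reflects-< v q
  ...     | true  | ofʸ v<q = ≤-<-trans v<q q<n
  ...     | false | _        = v<n

  shape⁻¹-<ᵇ : ∀ {v} → v < q → (i <ᵇ shape⁻¹ i q v) ≡ (i <ᵇ suc v)
  shape⁻¹-<ᵇ {v} v<q with v <? i
  ... | yes v<i rewrite shape⁻¹-< v<i | <ᵇ-false (<⇒≤ v<i) | <ᵇ-false v<i = refl
  ... | no  v≮i rewrite shape⁻¹-mid (≮⇒≥ v≮i) v<q = refl

  shape⁻¹-mono : ∀ {a b} → a < b → b < q → shape⁻¹ i q a ≤ shape⁻¹ i q b
  shape⁻¹-mono {a} {b} a<b b<q with a <? i | b <? i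
  ... | yes a<i | yes b<i rewrite shape⁻¹-< a<i | shape⁻¹-< b<i = <⇒≤ a<b
  ... | yes a<i | no  b≮i rewrite shape⁻¹-< a<i | shape⁻¹-mid (≮⇒≥ b≮i) b<q = m≤n⇒m≤1+n (<⇒≤ a<b)
  ... | no  a≮i | _
    rewrite shape⁻¹-mid (≮⇒≥ a≮i) (<-trans a<b b<q) | shape⁻¹-mid (≤-trans (≮⇒≥ a≮i) (<⇒≤ a<b)) b<q
    = s≤s (<⇒≤ a<b)

single-inject₁ : ∀ {n q m} (k : Fin n) → single q m (inject₁ k) ≡ single q m k
single-inject₁ {q = q} {m} k = cong (λ t → if t ≡ᵇ q then m else 0) (toℕ-inject₁ k)

inversionsAt-shape⁻¹ : ∀ {n i q} → i ≤ q → q < n → (v : Fin n) →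
                       inversionsAt (shape⁻¹ i q ∘ toℕ) v ≡ single q (q ∸ i) v
inversionsAt-shape⁻¹ {suc n} {i} {q} i≤q q<1+n v with lastView v | m≤n⇒m<n∨m≡n (s≤s⁻¹ q<1+n)
... | last | inj₁ q<n = begin
  inversionsAt (shape⁻¹ i q ∘ toℕ) (fromℕ n)  ≡⟨ inversionsAt-≡0 (shape⁻¹ i q ∘ toℕ) (fromℕ n) below-fixed ⟩
  0                                            ≡⟨ single-≢ n≢q ⟨
  single q (q ∸ i) (fromℕ n)                   ∎
  where
  below-fixed : ∀ j → toℕ j < toℕ (fromℕ n) → shape⁻¹ i q (toℕ j) ≤ shape⁻¹ i q (toℕ (fromℕ n))
  below-fixed j j<n rewrite toℕ-fromℕ n | shape⁻¹-> i≤q q<n = <⇒≤ (shape⁻¹-<n i≤q q<n j<n)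
  n≢q : toℕ (fromℕ n) ≢ q
  n≢q rewrite toℕ-fromℕ n = ≢-sym (<⇒≢ q<n)
... | last | inj₂ refl = begin
  inversionsAt (shape⁻¹ i q ∘ toℕ) (fromℕ q)                          ≡⟨ inversionsAt-last {q} (shape⁻¹ i q ∘ toℕ) ⟩
  count {q} (λ j → shape⁻¹ i q (toℕ (fromℕ q)) <ᵇ shape⁻¹ i q (toℕ (inject₁ j)))
                                                                       ≡⟨ count-cong moved-past ⟩
  count {q} (λ j → i <ᵇ suc (toℕ j))                                   ≡⟨ count-<ᵇ-suc q i ⟩
  q ∸ i                                                                ≡⟨ single-≡ (toℕ-fromℕ q) ⟨
  single q (q ∸ i) (fromℕ q)                                           ∎
  where
  moved-past : ∀ j → (shape⁻¹ i q (toℕ (fromℕ q)) <ᵇ shape⁻¹ i q (toℕ (inject₁ j))) ≡ (i <ᵇ suc (toℕ j))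
  moved-past j rewrite toℕ-fromℕ q | shape⁻¹-q i≤q | toℕ-inject₁ j = shape⁻¹-<ᵇ {i} (toℕ<n j)
... | init k | inj₁ q<n = begin
  inversionsAt (shape⁻¹ i q ∘ toℕ) (inject₁ k)            ≡⟨ inversionsAt-inject₁ {n} (shape⁻¹ i q ∘ toℕ) k ⟩
  inversionsAt (shape⁻¹ i q ∘ toℕ ∘ inject₁) k            ≡⟨ inversionsAt-cong-≗ (cong (shape⁻¹ i q) ∘ toℕ-inject₁) k ⟩
  inversionsAt (shape⁻¹ i q ∘ toℕ) k                      ≡⟨ inversionsAt-shape⁻¹ i≤q q<n k ⟩
  single q (q ∸ i) k                                      ≡⟨ single-inject₁ k ⟨
  single q (q ∸ i) (inject₁ k)                            ∎
... | init k | inj₂ refl = begin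
  inversionsAt (shape⁻¹ i q ∘ toℕ) (inject₁ k)            ≡⟨ inversionsAt-inject₁ {n} (shape⁻¹ i q ∘ toℕ) k ⟩
  inversionsAt (shape⁻¹ i q ∘ toℕ ∘ inject₁) k            ≡⟨ inversionsAt-≡0 (shape⁻¹ i q ∘ toℕ ∘ inject₁) k increasing ⟩
  0                                                       ≡⟨ single-≢ k≢q ⟨
  single q (q ∸ i) (inject₁ k)                            ∎
  where
  increasing : ∀ j → toℕ j < toℕ k → shape⁻¹ i q (toℕ (inject₁ j)) ≤ shape⁻¹ i q (toℕ (inject₁ k))
  increasing j j<k rewrite toℕ-inject₁ j | toℕ-inject₁ k = shape⁻¹-mono {i} j<k (toℕ<n k)
  k≢q : toℕ (inject₁ k) ≢ q
  k≢q rewrite toℕ-inject₁ k = <⇒≢ (toℕ<n k)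

shapePerm : ∀ {n} i q → i ≤ q → q < n → Permutation′ n
shapePerm {n} i q i≤q q<n = permutation to from to∘from from∘to
  where
  to : Fin n → Fin n
  to p = fromℕ< (shape₀-<n {i} q<n (toℕ<n p))
  from : Fin n → Fin n
  from v = fromℕ< (shape⁻¹-<n i≤q q<n (toℕ<n v))
  to∘from : ∀ v → to (from v) ≡ v
  to∘from v = toℕ-injective (begin
    toℕ (to (from v))                  ≡⟨ toℕ-fromℕ< _ ⟩
    shape₀ i q (toℕ (from v))          ≡⟨ cong (shape₀ i q) (toℕ-fromℕ< _) ⟩
    shape₀ i q (shape⁻¹ i q (toℕ v))   ≡⟨ shape₀-shape⁻¹ i≤q (toℕ v) ⟩
    toℕ v                              ∎)
  from∘to : ∀ p → from (to p) ≡ p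
  from∘to p = toℕ-injective (begin
    toℕ (from (to p))                  ≡⟨ toℕ-fromℕ< _ ⟩
    shape⁻¹ i q (toℕ (to p))           ≡⟨ cong (shape⁻¹ i q) (toℕ-fromℕ< _) ⟩
    shape⁻¹ i q (shape₀ i q (toℕ p))   ≡⟨ shape⁻¹-shape₀ i≤q (toℕ p) ⟩
    toℕ p                              ∎)

hasShape⇔≈shapePerm : ∀ {n i q} (i≤q : i ≤ q) (q<n : q < n) (w : Permutation′ n) →
                      HasShape w i (suc q) ⇔ w ≈ shapePerm i q i≤q q<n
hasShape⇔≈shapePerm {n} {i} {q} i≤q q<n w = mk⇔
  (λ w-shape p → toℕ-injective (suc-injective (begin
     suc (toℕ (w ⟨$⟩ʳ p))            ≡⟨ w-shape p ⟩
     shape i (suc q) (suc (toℕ p))   ≡⟨ suc-shape₀ i q (toℕ p) ⟨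
     suc (shape₀ i q (toℕ p))        ≡⟨ cong suc (toℕ-fromℕ< _) ⟨
     suc (toℕ (σ ⟨$⟩ʳ p))            ∎)))
  (λ w≈σ p → begin
     suc (toℕ (w ⟨$⟩ʳ p))            ≡⟨ cong (suc ∘ toℕ) (w≈σ p) ⟩
     suc (toℕ (σ ⟨$⟩ʳ p))            ≡⟨ cong suc (toℕ-fromℕ< _) ⟩
     suc (shape₀ i q (toℕ p))        ≡⟨ suc-shape₀ i q (toℕ p) ⟩
     shape i (suc q) (suc (toℕ p))   ∎)
  where
  σ : Permutation′ n
  σ = shapePerm i q i≤q q<n

invSeq-shapePerm : ∀ {n i q} (i≤q : i ≤ q) (q<n : q < n) v →
                   invSeq (shapePerm i q i≤q q<n) v ≡ single q (q ∸ i) v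
invSeq-shapePerm {n} {i} {q} i≤q q<n v = begin
  invSeq σ v                           ≡⟨ invSeq≡lehmer-flip σ v ⟩
  lehmer (flip σ) v                    ≡⟨ inversionsAt-cong-≗ {f = toℕ ∘ (flip σ ⟨$⟩ʳ_)} {shape⁻¹ i q ∘ toℕ}
                                                              (λ _ → toℕ-fromℕ< _) v ⟩
  inversionsAt (shape⁻¹ i q ∘ toℕ) v   ≡⟨ inversionsAt-shape⁻¹ i≤q q<n v ⟩
  single q (q ∸ i) v                   ∎
  where
  σ : Permutation′ n
  σ = shapePerm i q i≤q q<n

hasShape⇔single : ∀ {n i q} → i ≤ q → q < n → (w : Permutation′ n) →
                  HasShape w i (suc q) ⇔ (∀ v → invSeq w v ≡ single q (q ∸ i) v)
hasShape⇔single {n} {i} {q} i≤q q<n w = mk⇔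
  (λ w-shape v → trans (invSeq-cong w σ (Equivalence.to w-shape⇔ w-shape) v) (invSeq-shapePerm i≤q q<n v))
  (λ w-single → Equivalence.from w-shape⇔ (invSeq-injective w σ λ v →
                  trans (w-single v) (sym (invSeq-shapePerm i≤q q<n v))))
  where
  σ : Permutation′ n
  σ = shapePerm i q i≤q q<n
  w-shape⇔ : HasShape w i (suc q) ⇔ w ≈ σ
  w-shape⇔ = hasShape⇔≈shapePerm i≤q q<n w

+2≤suc⇔< : ∀ {i q} → i + 2 ≤ suc q ⇔ i < q
+2≤suc⇔< {i} {q} = mk⇔ (λ i+2≤1+q → s≤s⁻¹ (subst (_≤ suc q) (+-comm i 2) i+2≤1+q))
                      (λ i<q → subst (_≤ suc q) (+-comm 2 i) (s≤s i<q))

lemma4p1 : (n : ℕ) (w : Permutation′ n) →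
    JoinIrreducible w ⇔
      ∃₂ (λ (i j : ℕ) → (i + 2 ≤ n) × (i + 2 ≤ j) × (j ≤ n) × HasShape w i j)
lemma4p1 n w = mk⇔ shape-of-irreducible irreducible-of-shape
  where
  shape-of-irreducible : JoinIrreducible w → ∃₂ λ i j → (i + 2 ≤ n) × (i + 2 ≤ j) × (j ≤ n) × HasShape w i j
  shape-of-irreducible w-irreducible =
    let (q , m , 0<m , m≤q , q<n , w-single) = joinIrreducible⇒single w w-irreducible
        i+2≤1+q = Equivalence.from +2≤suc⇔< (∸-monoʳ-< 0<m m≤q)
        w-single′ = λ v → trans (w-single v) (cong (λ k → single q k v) (sym (m∸[m∸n]≡n m≤q)))
    in  q ∸ m , suc q , ≤-trans i+2≤1+q q<n , i+2≤1+q , q<n ,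
        Equivalence.from (hasShape⇔single (m∸n≤m q m) q<n w) w-single′
  irreducible-of-shape : ∃₂ (λ i j → (i + 2 ≤ n) × (i + 2 ≤ j) × (j ≤ n) × HasShape w i j) → JoinIrreducible w
  irreducible-of-shape (i , zero , _ , i+2≤0 , _) = contradiction (m+n≤o⇒n≤o i i+2≤0) λ ()
  irreducible-of-shape (i , suc q , _ , i+2≤1+q , q<n , w-shape) =
    let i<q = Equivalence.to +2≤suc⇔< i+2≤1+q
    in  single⇒joinIrreducible w q<n (m<n⇒0<n∸m i<q)
          (Equivalence.to (hasShape⇔single (<⇒≤ i<q) q<n w) w-shape)
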